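{- Let $d$ be a nonnegative integer. If $\mathcal F$ is a $d$-degenerate minor-closed family of graphs, then every graph $G$ in $\mathcal F$ is conflict-free $(2d+1)$-choosable.
   Context: All graphs are finite and simple. A graph is $d$-degenerate if every subgraph of it has a vertex of degree at most $d$; a class is $d$-degenerate if all its members are. A class is minor-closed if every minor of a member is a member. For a real number $k$, a $k$-list-assignment of $G$ assigns to each vertex $v$ a set $L(v)$ with $|L(v)|\ge k$; an $L$-coloring $\phi$ has $\phi(v)\in L(v)$ for all $v$; it is proper if adjacent vertices get different colors; it is conflict-free if for every vertex $v$ with $N_G(v)\ne\emptyset$ there is a color appearing exactly once on $N_G(v)$ (the open neighbourhood). $G$ is conflict-free $k$-choosable if for every $k$-list-assignment $L$ of $G$ there exists a proper conflict-free $L$-coloring of $G$. -}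

module Defs where

open import Data.Nat using (ℕ; zero; suc; _+_; _≤_; _≥_)
open import Data.Bool using (Bool; true; false; if_then_else_; _∧_)
open import Data.Fin using (Fin; zero; suc)
open import Data.List using (List; length)
open import Data.List.Membership.Propositional using (_∈_)
open import Data.List.Relation.Unary.Unique.Propositional using (Unique)
open import Data.Product using (Σ; ∃; _×_; _,_)
open import Relation.Binary.PropositionalEquality using (_≡_; _≢_)
open import Relation.Binary.Construct.Closure.ReflexiveTransitive using (Star)
open import Relation.Nullary using (¬_)
open import Function.Definitions using (Injective)

record Graph : Set where
  field
    n     : ℕ
    adj   : Fin n → Fin n → Bool
    sym   : ∀ u v → adj u v ≡ adj v u
    irref : ∀ v → adj v v ≡ false
open Graph public

countTrue : ∀ {m} → (Fin m → Bool) → ℕ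
countTrue {zero}  f = 0
countTrue {suc m} f = (if f zero then 1 else 0) + countTrue (λ i → f (suc i))

degree : (G : Graph) → Fin (n G) → ℕ
degree G v = countTrue (adj G v)

IsSubgraph : Graph → Graph → Set
IsSubgraph H G = Σ (Fin (n H) → Fin (n G)) λ f →
  Injective _≡_ _≡_ f × (∀ u v → adj H u v ≡ true → adj G (f u) (f v) ≡ true)

Degenerate : ℕ → Graph → Set
Degenerate d G = ∀ (H : Graph) → IsSubgraph H G → n H ≥ 1 →
  ∃ λ (v : Fin (n H)) → degree H v ≤ d

DegenerateClass : ℕ → (Graph → Set) → Set
DegenerateClass d F = ∀ G → F G → Degenerate d G

AdjIn : (G : Graph) → (Fin (n G) → Bool) → Fin (n G) → Fin (n G) → Set
AdjIn G S x y = (S x ≡ true) × (S y ≡ true) × (adj G x y ≡ true)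

ConnectedSet : (G : Graph) → (Fin (n G) → Bool) → Set
ConnectedSet G S = ∀ x y → S x ≡ true → S y ≡ true → Star (AdjIn G S) x y

IsMinor : Graph → Graph → Set
IsMinor H G = Σ (Fin (n H) → Fin (n G) → Bool) λ B →
    (∀ u → ∃ λ x → B u x ≡ true)
  × (∀ u v x → u ≢ v → B u x ≡ true → B v x ≡ false)
  × (∀ u → ConnectedSet G (B u))
  × (∀ u v → adj H u v ≡ true →
       ∃ λ x → ∃ λ y → (B u x ≡ true) × (B v y ≡ true) × (adj G x y ≡ true))

MinorClosed : (Graph → Set) → Set
MinorClosed F = ∀ G H → F G → IsMinor H G → F H

ListAssignment : Graph → ℕ → Set
ListAssignment G k = Σ (Fin (n G) → List ℕ) λ L →
  ∀ v → Unique (L v) × length (L v) ≥ k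

_==_ : ℕ → ℕ → Bool
zero  == zero  = true
zero  == suc _ = false
suc _ == zero  = false
suc a == suc b = a == b

IsLColoring : (G : Graph) → (Fin (n G) → List ℕ) → (Fin (n G) → ℕ) → Set
IsLColoring G L φ = ∀ v → φ v ∈ L v

Proper : (G : Graph) → (Fin (n G) → ℕ) → Set
Proper G φ = ∀ u v → adj G u v ≡ true → φ u ≢ φ v

ConflictFree : (G : Graph) → (Fin (n G) → ℕ) → Set
ConflictFree G φ = ∀ v → (∃ λ u → adj G v u ≡ true) →
  ∃ λ c → countTrue (λ u → adj G v u ∧ (φ u == c)) ≡ 1

CFChoosable : Graph → ℕ → Set
CFChoosable G k = ∀ (L : ListAssignment G k) →
  ∃ λ (φ : Fin (n G) → ℕ) →
    IsLColoring G (Data.Product.proj₁ L) φ × Proper G φ × ConflictFree G φ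

{-# OPTIONS --safe #-}
module Submission where

-- Induct on the number of vertices, strengthening the claim: for every "demand" relation
-- E ⊆ adj there is a proper L-colouring in which each vertex x with an E-neighbour has an
-- E-neighbour whose colour no other E-neighbour of x repeats. Pick t of degree ≤ d. If t
-- demands nothing, delete it; otherwise contract t into a demanded neighbour p. The result is a
-- minor, hence in the class, and its colouring serves t's demand through p, since p became
-- adjacent to all other neighbours of t. Finally t takes a colour from its 2d + 1 list avoiding
-- the colours of its ≤ d neighbours and of their ≤ d witnesses.

open import Defs hiding (sym)
open import Function using (_∘_; id)
open import Data.Nat using (ℕ; zero; suc; _+_; _*_; _≤_; _<_; z≤n; s≤s)
open import Data.Nat.Properties
  using (+-identityʳ; +-mono-≤; ≤-trans; ≤-pred; m≤n+m; m<m+n; +-commutativeSemigroup;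
         module ≤-Reasoning)
  renaming (_≟_ to _≟ℕ_)
open import Algebra.Properties.CommutativeSemigroup +-commutativeSemigroup using (x∙yz≈y∙xz)
open import Data.Bool using (Bool; true; false; _∧_; _∨_; not; if_then_else_)
open import Data.Bool.Properties using (∨-comm) renaming (_≟_ to _≟ᴮ_)
open import Data.Fin using (Fin; zero; suc; punchIn; punchOut)
open import Data.Fin.Properties using (_≟_; punchInᵢ≢i; punchIn-punchOut; any?)
open import Data.Maybe using (Maybe; just; nothing; maybe′)
open import Data.Maybe.Properties using (just-injective) renaming (≡-dec to ≡-decᴹ)
open import Data.Vec.Functional using (insertAt)
open import Data.Vec.Functional.Properties using (insertAt-lookup; insertAt-punchIn)
open import Data.List using (List; []; _∷_; length; _++_; filter)
open import Data.List.Properties using (length-++; filter-notAll)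
open import Data.List.Membership.Propositional using (_∈_; _∉_)
open import Data.List.Membership.Propositional.Properties using (∈-++⁺ˡ; ∈-++⁺ʳ; ∈-filter⁺)
open import Data.List.Relation.Unary.Any as Any using (here; there)
open import Data.List.Relation.Unary.All as All using ()
open import Data.List.Relation.Unary.AllPairs using (_∷_)
open import Data.List.Relation.Unary.Unique.Propositional using (Unique)
open import Data.Product using (∃; _×_; _,_; proj₁; proj₂)
open import Data.Sum using (_⊎_; inj₁; inj₂)
open import Data.Empty using (⊥; ⊥-elim)
open import Relation.Nullary using (Dec; yes; no; does; ¬?; contradiction)
open import Relation.Nullary.Decidable using (dec-true; dec-false)
open import Relation.Binary.Definitions using (DecidableEquality)
open import Relation.Binary.PropositionalEquality
  using (_≡_; _≢_; refl; sym; trans; cong; cong₂; subst; ≢-sym)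
open import Relation.Binary.Construct.Closure.ReflexiveTransitive using (ε; _◅_)

∧-true⁺ : ∀ {x y} → x ≡ true → y ≡ true → x ∧ y ≡ true
∧-true⁺ refl y≡true = y≡true

∧-true⁻ : ∀ {x y} → x ∧ y ≡ true → x ≡ true × y ≡ true
∧-true⁻ {true}  y≡true = refl , y≡true
∧-true⁻ {false} ()

∨-true⁺ˡ : ∀ {x y} → x ≡ true → x ∨ y ≡ true
∨-true⁺ˡ refl = refl

∨-true⁺ʳ : ∀ {x y} → y ≡ true → x ∨ y ≡ true
∨-true⁺ʳ {true}  _      = refl
∨-true⁺ʳ {false} y≡true = y≡true

∨-true⁻ : ∀ {x y} → x ∨ y ≡ true → x ≡ true ⊎ y ≡ true
∨-true⁻ {true}  _      = inj₁ refl
∨-true⁻ {false} y≡true = inj₂ y≡true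

does-true : ∀ {A : Set} (a? : Dec A) → does a? ≡ true → A
does-true (yes a) _ = a
does-true (no _) ()

==-refl : ∀ c → (c == c) ≡ true
==-refl zero    = refl
==-refl (suc c) = ==-refl c

==-≢ : ∀ {c c′} → c ≢ c′ → (c == c′) ≡ false
==-≢ {zero}  {zero}   c≢c′ = contradiction refl c≢c′
==-≢ {zero}  {suc _}  _    = refl
==-≢ {suc _} {zero}   _    = refl
==-≢ {suc c} {suc c′} c≢c′ = ==-≢ (c≢c′ ∘ cong suc)

countTrue-punchIn : ∀ {m} (f : Fin (suc m) → Bool) (t : Fin (suc m)) →
  countTrue f ≡ (if f t then 1 else 0) + countTrue (f ∘ punchIn t)
countTrue-punchIn f zero = refl
countTrue-punchIn {suc m} f (suc t) =
  trans (cong ((if f zero then 1 else 0) +_) (countTrue-punchIn (f ∘ suc) t))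
        (x∙yz≈y∙xz (if f zero then 1 else 0) (if f (suc t) then 1 else 0) _)

countTrue-≡0 : ∀ {m} (f : Fin m → Bool) → (∀ i → f i ≡ false) → countTrue f ≡ 0
countTrue-≡0 {zero}  f all-false = refl
countTrue-≡0 {suc m} f all-false rewrite all-false zero = countTrue-≡0 (f ∘ suc) (all-false ∘ suc)

countTrue-≡1 : ∀ {m} (f : Fin m → Bool) (w : Fin m) → f w ≡ true →
  (∀ z → z ≢ w → f z ≡ false) → countTrue f ≡ 1
countTrue-≡1 {suc m} f w fw≡true others rewrite countTrue-punchIn f w | fw≡true =
  cong suc (countTrue-≡0 _ (λ j → others (punchIn w j) (punchInᵢ≢i w j)))

valuesOn : ∀ {m} {A : Set} → (Fin m → Bool) → (Fin m → A) → List A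
valuesOn {zero}  p f = []
valuesOn {suc m} p f = if p zero then f zero ∷ rest else rest
  where rest = valuesOn (p ∘ suc) (f ∘ suc)

length-valuesOn : ∀ {m} {A : Set} (p : Fin m → Bool) (f : Fin m → A) →
  length (valuesOn p f) ≡ countTrue p
length-valuesOn {zero}  p f = refl
length-valuesOn {suc m} p f with p zero
... | true  = cong suc (length-valuesOn (p ∘ suc) (f ∘ suc))
... | false = length-valuesOn (p ∘ suc) (f ∘ suc)

∈-valuesOn : ∀ {m} {A : Set} (p : Fin m → Bool) (f : Fin m → A) (i : Fin m) →
  p i ≡ true → f i ∈ valuesOn p f
∈-valuesOn p f zero    pi≡true rewrite pi≡true = here refl
∈-valuesOn p f (suc i) pi≡true with p zero
... | true  = there (∈-valuesOn (p ∘ suc) (f ∘ suc) i pi≡true)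
... | false = ∈-valuesOn (p ∘ suc) (f ∘ suc) i pi≡true

module _ {A : Set} (_≟ᴬ_ : DecidableEquality A) where
  open import Data.List.Membership.DecPropositional _≟ᴬ_ using (_∈?_)

  without : A → List A → List A
  without x = filter (λ y → ¬? (y ≟ᴬ x))

  longer-unique⇒∃∉ : ∀ {xs ys : List A} → Unique xs → length ys < length xs →
    ∃ λ x → x ∈ xs × x ∉ ys
  longer-unique⇒∃∉ {x ∷ xs} {ys} (x∉xs ∷ xs-unique) |ys|<|x∷xs| with x ∈? ys
  ... | no x∉ys = x , here refl , x∉ys
  ... | yes x∈ys with longer-unique⇒∃∉ {ys = without x ys} xs-unique
         (≤-trans (filter-notAll _ ys (Any.map (λ x≡y y≢x → y≢x (sym x≡y)) x∈ys))
                  (≤-pred |ys|<|x∷xs|))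
  ... | z , z∈xs , z∉ys-x =
    z , there z∈xs , λ z∈ys → z∉ys-x (∈-filter⁺ _ z∈ys (≢-sym (All.lookup x∉xs z∈xs)))

data PunchView {k} (t : Fin (suc k)) : Fin (suc k) → Set where
  at      : PunchView t t
  punched : (j : Fin k) → PunchView t (punchIn t j)

punchView : ∀ {k} (t x : Fin (suc k)) → PunchView t x
punchView t x with t ≟ x
... | yes refl = at
... | no t≢x   = subst (PunchView t) (punchIn-punchOut t≢x) (punched (punchOut t≢x))

isSubgraph-refl : ∀ G → IsSubgraph G G
isSubgraph-refl G = id , id , λ _ _ uv → uv

record DemandColouring (G : Graph) (E : Fin (n G) → Fin (n G) → Bool)
                       (L : Fin (n G) → List ℕ) : Set where
  field
    colour           : Fin (n G) → ℕ
    colour∈L         : IsLColoring G L colour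
    proper           : Proper G colour
    witness          : Fin (n G) → Fin (n G)
    witness-demanded : ∀ x y → E x y ≡ true → E x (witness x) ≡ true
    witness-unique   : ∀ x z → E x z ≡ true → z ≢ witness x → colour z ≢ colour (witness x)

demandColouring⇒conflictFree : ∀ {G L} (φ : DemandColouring G (adj G) L) →
  ConflictFree G (DemandColouring.colour φ)
demandColouring⇒conflictFree {G} φ v (u , vu) =
  colour (witness v) ,
  countTrue-≡1 _ (witness v) (∧-true⁺ (witness-demanded v u vu) (==-refl (colour (witness v)))) others
  where
  open DemandColouring φ
  others : ∀ z → z ≢ witness v → (adj G v z ∧ (colour z == colour (witness v))) ≡ false
  others z z≢w with adj G v z in vz
  ... | false = refl
  ... | true  = ==-≢ (witness-unique v z vz z≢w)

module Contraction {k : ℕ} (a : Fin (suc k) → Fin (suc k) → Bool)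
    (a-sym : ∀ u v → a u v ≡ a v u) (a-irrefl : ∀ v → a v v ≡ false)
    -- nothing deletes t; just p contracts the edge between t and punchIn t p
    (t : Fin (suc k)) (absorber : Maybe (Fin k))
    (absorber-adj : ∀ {p} → absorber ≡ just p → a t (punchIn t p) ≡ true) where

  K : Graph
  K = record { n = suc k ; adj = a ; sym = a-sym ; irref = a-irrefl }

  no-loop : ∀ v → a v v ≡ true → ⊥
  no-loop v vv = contradiction (trans (sym vv) (a-irrefl v)) λ ()

  absorbs : Fin k → Bool
  absorbs i = does (≡-decᴹ _≟_ (just i) absorber)

  absorbs⇒≡just : ∀ i → absorbs i ≡ true → absorber ≡ just i
  absorbs⇒≡just i = sym ∘ does-true (≡-decᴹ _≟_ (just i) absorber)

  ≡just⇒absorbs : ∀ {i} → absorber ≡ just i → absorbs i ≡ true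
  ≡just⇒absorbs {i} ≡just = dec-true (≡-decᴹ _≟_ (just i) absorber) (sym ≡just)

  -- the conjunct not (absorbs j) only rules out a loop at the absorber
  joins : Fin k → Fin k → Bool
  joins i j = absorbs i ∧ not (absorbs j) ∧ a t (punchIn t j)

  joins⇒ : ∀ {i j} → joins i j ≡ true → absorbs i ≡ true × a t (punchIn t j) ≡ true
  joins⇒ ij with ∧-true⁻ ij
  ... | absorbs-i , rest = absorbs-i , proj₂ (∧-true⁻ rest)

  contractedAdj : Fin k → Fin k → Bool
  contractedAdj i j = a (punchIn t i) (punchIn t j) ∨ (joins i j ∨ joins j i)

  contractedAdj-sym : ∀ i j → contractedAdj i j ≡ contractedAdj j i
  contractedAdj-sym i j = cong₂ _∨_ (a-sym _ _) (∨-comm (joins i j) (joins j i))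

  contractedAdj-irrefl : ∀ i → contractedAdj i i ≡ false
  contractedAdj-irrefl i rewrite a-irrefl (punchIn t i) with absorbs i
  ... | true  = refl
  ... | false = refl

  contracted : Graph
  contracted = record
    { n = k ; adj = contractedAdj ; sym = contractedAdj-sym ; irref = contractedAdj-irrefl }

  contractedAdj-old : ∀ {i j} → a (punchIn t i) (punchIn t j) ≡ true → contractedAdj i j ≡ true
  contractedAdj-old = ∨-true⁺ˡ

  contractedAdj-new : ∀ {p j} → absorber ≡ just p → j ≢ p → a t (punchIn t j) ≡ true →
    contractedAdj p j ≡ true
  contractedAdj-new {p} {j} ≡just j≢p tj =
    ∨-true⁺ʳ {a (punchIn t p) (punchIn t j)} (∨-true⁺ˡ {y = joins j p} p-joins-j)
    where
    j-absent : absorbs j ≡ false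
    j-absent = dec-false (≡-decᴹ _≟_ (just j) absorber) (λ j≡ → j≢p (just-injective (trans j≡ ≡just)))
    p-joins-j : joins p j ≡ true
    p-joins-j = ∧-true⁺ (≡just⇒absorbs ≡just) (∧-true⁺ (cong not j-absent) tj)

  branch : Fin k → Fin (suc k) → Bool
  branch u = insertAt (λ j → does (j ≟ u)) t (absorbs u)

  branch-at : ∀ u → branch u t ≡ true → absorber ≡ just u
  branch-at u ut = absorbs⇒≡just u (trans (sym (insertAt-lookup _ t _)) ut)

  branch-punched : ∀ u j → branch u (punchIn t j) ≡ true → j ≡ u
  branch-punched u j uj = does-true (j ≟ u) (trans (sym (insertAt-punchIn _ t _ j)) uj)

  branch-self : ∀ u → branch u (punchIn t u) ≡ true
  branch-self u = trans (insertAt-punchIn _ t _ u) (dec-true (u ≟ u) refl)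

  branch-absorber : ∀ {u} → absorber ≡ just u → branch u t ≡ true
  branch-absorber ≡just = trans (insertAt-lookup _ t _) (≡just⇒absorbs ≡just)

  branch-disjoint : ∀ u v x → u ≢ v → branch u x ≡ true → branch v x ≡ false
  branch-disjoint u v x u≢v ux with punchView t x
  ... | at = trans (insertAt-lookup _ t _)
                   (dec-false (≡-decᴹ _≟_ (just v) absorber)
                              (λ v≡ → u≢v (just-injective (trans (sym (branch-at u ux)) (sym v≡)))))
  ... | punched j = trans (insertAt-punchIn _ t _ j)
                          (dec-false (j ≟ v) (λ j≡v → u≢v (trans (sym (branch-punched u j ux)) j≡v)))

  branch-connected : ∀ u → ConnectedSet K (branch u)
  branch-connected u x y ux uy with punchView t x | punchView t y
  ... | at        | at        = ε
  ... | at        | punched j with refl ← branch-punched u j uy =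
    (ux , uy , absorber-adj (branch-at u ux)) ◅ ε
  ... | punched i | at        with refl ← branch-punched u i ux =
    (ux , uy , trans (a-sym _ t) (absorber-adj (branch-at u uy))) ◅ ε
  ... | punched i | punched j with refl ← branch-punched u i ux | refl ← branch-punched u j uy = ε

  branch-edge : ∀ u v → contractedAdj u v ≡ true →
    ∃ λ x → ∃ λ y → (branch u x ≡ true) × (branch v y ≡ true) × (a x y ≡ true)
  branch-edge u v uv with ∨-true⁻ uv
  ... | inj₁ old = punchIn t u , punchIn t v , branch-self u , branch-self v , old
  ... | inj₂ new with ∨-true⁻ new
  ...   | inj₁ u-joins = let absorbs-u , tv = joins⇒ u-joins in
    t , punchIn t v , branch-absorber (absorbs⇒≡just u absorbs-u) , branch-self v , tv
  ...   | inj₂ v-joins = let absorbs-v , tu = joins⇒ v-joins in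
    punchIn t u , t , branch-self u , branch-absorber (absorbs⇒≡just v absorbs-v) , trans (a-sym _ t) tu

  contracted-isMinor : IsMinor contracted K
  contracted-isMinor =
    branch , (λ u → punchIn t u , branch-self u) , branch-disjoint , branch-connected , branch-edge

  module Extension {d : ℕ} (E : Fin (suc k) → Fin (suc k) → Bool)
      (E⊆a : ∀ u v → E u v ≡ true → a u v ≡ true) (L : ListAssignment K (2 * d + 1)) where

    E/ : Fin k → Fin k → Bool
    E/ i j = E (punchIn t i) (punchIn t j)

    E/⊆contractedAdj : ∀ i j → E/ i j ≡ true → contractedAdj i j ≡ true
    E/⊆contractedAdj i j = contractedAdj-old ∘ E⊆a _ _

    L/ : ListAssignment contracted (2 * d + 1)
    L/ = proj₁ L ∘ punchIn t , proj₂ L ∘ punchIn t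

    module _ (t-degree : degree K t ≤ d)
        (demand-absorbed : ∀ y → E t y ≡ true →
          ∃ λ p → absorber ≡ just p × E t (punchIn t p) ≡ true)
        (φ/ : DemandColouring contracted E/ (proj₁ L/)) where

      open DemandColouring φ/ renaming
        (colour to colour/; colour∈L to colour/∈L; proper to proper/; witness to witness/;
         witness-demanded to witness/-demanded; witness-unique to witness/-unique)

      t-nbr : Fin k → Bool
      t-nbr j = a t (punchIn t j)

      forbidden : List ℕ
      forbidden = valuesOn t-nbr colour/ ++ valuesOn t-nbr (colour/ ∘ witness/)

      forbidden-shorter : length forbidden < length (proj₁ L t)
      forbidden-shorter = begin-strict
        length forbidden
          ≡⟨ length-++ (valuesOn t-nbr colour/) ⟩
        length (valuesOn t-nbr colour/) + length (valuesOn t-nbr (colour/ ∘ witness/))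
          ≡⟨ cong₂ _+_ (length-valuesOn t-nbr colour/) (length-valuesOn t-nbr (colour/ ∘ witness/)) ⟩
        countTrue t-nbr + countTrue t-nbr
          ≤⟨ +-mono-≤ t-nbr-count t-nbr-count ⟩
        d + d
          ≡⟨ cong (d +_) (sym (+-identityʳ d)) ⟩
        2 * d
          <⟨ m<m+n (2 * d) (s≤s z≤n) ⟩
        2 * d + 1
          ≤⟨ proj₂ (proj₂ L t) ⟩
        length (proj₁ L t) ∎
        where
        open ≤-Reasoning
        t-nbr-count : countTrue t-nbr ≤ d
        t-nbr-count = ≤-trans (m≤n+m _ _) (subst (_≤ d) (countTrue-punchIn (a t) t) t-degree)

      free : ∃ λ c → c ∈ proj₁ L t × c ∉ forbidden
      free = longer-unique⇒∃∉ _≟ℕ_ (proj₁ (proj₂ L t)) forbidden-shorter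

      c₀ : ℕ
      c₀ = proj₁ free

      c₀≢t-nbr : ∀ j → t-nbr j ≡ true → c₀ ≢ colour/ j
      c₀≢t-nbr j tj c₀≡ = proj₂ (proj₂ free)
        (subst (_∈ forbidden) (sym c₀≡) (∈-++⁺ˡ (∈-valuesOn t-nbr colour/ j tj)))

      c₀≢t-nbr-witness : ∀ j → t-nbr j ≡ true → c₀ ≢ colour/ (witness/ j)
      c₀≢t-nbr-witness j tj c₀≡ = proj₂ (proj₂ free)
        (subst (_∈ forbidden) (sym c₀≡)
               (∈-++⁺ʳ (valuesOn t-nbr colour/) (∈-valuesOn t-nbr (colour/ ∘ witness/) j tj)))

      colour : Fin (suc k) → ℕ
      colour = insertAt colour/ t c₀

      colour-t : colour t ≡ c₀
      colour-t = insertAt-lookup colour/ t c₀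

      colour-punchIn : ∀ j → colour (punchIn t j) ≡ colour/ j
      colour-punchIn = insertAt-punchIn colour/ t c₀

      colour∈L : IsLColoring K (proj₁ L) colour
      colour∈L x with punchView t x
      ... | at        rewrite colour-t          = proj₁ (proj₂ free)
      ... | punched j rewrite colour-punchIn j = colour/∈L j

      proper : Proper K colour
      proper u v uv with punchView t u | punchView t v
      ... | at        | at        = ⊥-elim (no-loop t uv)
      ... | at        | punched j rewrite colour-t | colour-punchIn j = c₀≢t-nbr j uv
      ... | punched i | at        rewrite colour-t | colour-punchIn i =
        ≢-sym (c₀≢t-nbr i (trans (a-sym t _) uv))
      ... | punched i | punched j rewrite colour-punchIn i | colour-punchIn j =
        proper/ i j (contractedAdj-old uv)

      -- if j demands nothing in the contraction, t is its only possible demanded neighbour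
      witnessOf : Fin k → Fin (suc k)
      witnessOf j = if E/ j (witness/ j) then punchIn t (witness/ j) else t

      -- the default t is junk: it is used only when t demands nothing
      witness : Fin (suc k) → Fin (suc k)
      witness = insertAt witnessOf t (maybe′ (punchIn t) t absorber)

      witness-t : ∀ {p} → absorber ≡ just p → witness t ≡ punchIn t p
      witness-t ≡just = trans (insertAt-lookup witnessOf t _) (cong (maybe′ (punchIn t) t) ≡just)

      witness-punchIn : ∀ j → witness (punchIn t j) ≡ witnessOf j
      witness-punchIn = insertAt-punchIn witnessOf t _

      witnessOf-demanded : ∀ j y → E (punchIn t j) y ≡ true → E (punchIn t j) (witnessOf j) ≡ true
      witnessOf-demanded j y jy with E/ j (witness/ j) in jw | punchView t y
      ... | true  | _         = jw
      ... | false | at        = jy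
      ... | false | punched i = contradiction (trans (sym (witness/-demanded j i jy)) jw) λ ()

      witness-demanded : ∀ x y → E x y ≡ true → E x (witness x) ≡ true
      witness-demanded x y xy with punchView t x
      ... | punched j rewrite witness-punchIn j = witnessOf-demanded j y xy
      ... | at with demand-absorbed y xy
      ...   | p , ≡just , tp rewrite witness-t ≡just = tp

      witnessOf-unique : ∀ j z → E (punchIn t j) z ≡ true → z ≢ witnessOf j →
        colour z ≢ colour (witnessOf j)
      witnessOf-unique j z jz z≢w with E/ j (witness/ j) in jw | punchView t z
      ... | true  | at rewrite colour-t | colour-punchIn (witness/ j) =
        c₀≢t-nbr-witness j (trans (a-sym t _) (E⊆a _ _ jz))
      ... | true  | punched i rewrite colour-punchIn i | colour-punchIn (witness/ j) =
        witness/-unique j i jz (z≢w ∘ cong (punchIn t))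
      ... | false | at        = contradiction refl z≢w
      ... | false | punched i = contradiction (trans (sym (witness/-demanded j i jz)) jw) λ ()

      absorber-unique : ∀ p → absorber ≡ just p → ∀ z → E t z ≡ true → z ≢ punchIn t p →
        colour z ≢ colour (punchIn t p)
      absorber-unique p ≡just z tz z≢p with punchView t z
      ... | at        = ⊥-elim (no-loop t (E⊆a t t tz))
      ... | punched j rewrite colour-punchIn j | colour-punchIn p =
        ≢-sym (proper/ p j (contractedAdj-new ≡just (z≢p ∘ cong (punchIn t)) (E⊆a _ _ tz)))

      witness-unique : ∀ x z → E x z ≡ true → z ≢ witness x → colour z ≢ colour (witness x)
      witness-unique x z xz with punchView t x
      ... | punched j rewrite witness-punchIn j = witnessOf-unique j z xz
      ... | at with demand-absorbed z xz
      ...   | p , ≡just , _ rewrite witness-t ≡just = absorber-unique p ≡just z xz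

      extended : DemandColouring K E (proj₁ L)
      extended = record
        { colour = colour ; colour∈L = colour∈L ; proper = proper ; witness = witness
        ; witness-demanded = witness-demanded ; witness-unique = witness-unique }

chooseAbsorber : ∀ {k} (a : Fin (suc k) → Fin (suc k) → Bool) → (∀ v → a v v ≡ false) →
  (E : Fin (suc k) → Fin (suc k) → Bool) → (∀ u v → E u v ≡ true → a u v ≡ true) →
  (t : Fin (suc k)) →
  ∃ λ (absorber : Maybe (Fin k)) →
      (∀ {p} → absorber ≡ just p → a t (punchIn t p) ≡ true)
    × (∀ y → E t y ≡ true → ∃ λ p → absorber ≡ just p × E t (punchIn t p) ≡ true)
chooseAbsorber a a-irrefl E E⊆a t with any? (λ y → E t y ≟ᴮ true)
... | no no-demand = nothing , (λ ()) , (λ y ty → contradiction (y , ty) no-demand)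
... | yes (y , ty) with punchView t y
...   | at        = contradiction (trans (sym (E⊆a t t ty)) (a-irrefl t)) λ ()
...   | punched p = just p , (λ { refl → E⊆a _ _ ty }) , (λ _ _ → p , refl , ty)

module _ {d : ℕ} {F : Graph → Set} (F-minorClosed : MinorClosed F)
    (F-degenerate : DegenerateClass d F) where

  demandColouring : ∀ m (G : Graph) → n G ≡ m → F G →
    (E : Fin (n G) → Fin (n G) → Bool) → (∀ u v → E u v ≡ true → adj G u v ≡ true) →
    (L : ListAssignment G (2 * d + 1)) → DemandColouring G E (proj₁ L)
  demandColouring zero G refl _ _ _ _ = record
    { colour = λ () ; colour∈L = λ () ; proper = λ () ; witness = λ ()
    ; witness-demanded = λ () ; witness-unique = λ () }
  demandColouring (suc k) G@(record { n = .(suc k) ; adj = a ; sym = a-sym ; irref = a-irrefl })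
      refl G∈F E E⊆a L
    with F-degenerate G G∈F G (isSubgraph-refl G) (s≤s z≤n)
  ... | t , t-degree with chooseAbsorber a a-irrefl E E⊆a t
  ... | absorber , absorber-adj , demand-absorbed =
    extended t-degree demand-absorbed
      (demandColouring k contracted refl (F-minorClosed G contracted G∈F contracted-isMinor)
                       E/ E/⊆contractedAdj L/)
    where
    open Contraction a a-sym a-irrefl t absorber absorber-adj
    open Extension {d} E E⊆a L

theorem1p4 : (d : ℕ) (F : Graph → Set) → MinorClosed F → DegenerateClass d F →
    ∀ (G : Graph) → F G → CFChoosable G (2 * d + 1)
theorem1p4 d F F-minorClosed F-degenerate G G∈F L =
  colour , colour∈L , proper , demandColouring⇒conflictFree φ
  where
  φ : DemandColouring G (adj G) (proj₁ L)
  φ = demandColouring F-minorClosed F-degenerate (n G) G refl G∈F (adj G) (λ _ _ uv → uv) L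
  open DemandColouring φ
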